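{- Let $(\sigma_0,\sigma_1,\dots,\sigma_t)$ be a sequence of swaps. For any two integers $i<j$ in $\{0,1,\dots,t\}$ and any agent $q\in N$, if $\sigma_i(q)=\sigma_j(q)$, then $\sigma_d(q)=\sigma_i(q)$ for every integer $d$ with $i\le d\le j$.
   Context: Agents $N=\{1,\dots,n\}$ lie on a path in this order (edges between $i$ and $i+1$); objects $O=\{o_1,\dots,o_n\}$; each agent $i$ has a strict preference $\succ_i$ (a linear order on $O$); the initial assignment is $\sigma_0(i)=o_i$. An assignment is a bijection $N\to O$. A swap exchanges the objects of two adjacent agents $i,i+1$ in an assignment $\sigma$ and is allowed only if $\sigma(i+1)\succ_i\sigma(i)$ and $\sigma(i)\succ_{i+1}\sigma(i+1)$. A sequence of swaps $(\sigma_0,\dots,\sigma_t)$ is a sequence of assignments starting at the initial assignment in which each $\sigma_{r}$ is obtained from $\sigma_{r-1}$ by an allowed swap. -}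

module Defs where

open import Level using (0ℓ)
open import Data.Nat using (ℕ; suc)
open import Data.Fin using (Fin; inject₁; suc; _≟_)
open import Data.Product using (Σ; _×_; ∃)
open import Relation.Nullary using (yes; no)
open import Relation.Binary using (IsStrictTotalOrder)
open import Relation.Binary.PropositionalEquality using (_≡_)
open import Function using (Bijective)

-- Agents are Fin (suc m) (n = suc m agents), objects are Fin (suc m);
-- object o_k is identified with index k, so the initial assignment is the identity.
-- Agent k : Fin (suc m) is adjacent to its successor.

record Profile (m : ℕ) : Set₁ where
  field
    _≻[_]_ : Fin (suc m) → Fin (suc m) → Fin (suc m) → Set
    isSTO  : (i : Fin (suc m)) → IsStrictTotalOrder _≡_ (λ x y → x ≻[ i ] y)
open Profile public

record Assignment (m : ℕ) : Set where
  constructor assign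
  field
    obj : Fin (suc m) → Fin (suc m)
    bij : Bijective _≡_ _≡_ obj
open Assignment public

swapAt : ∀ {m} → Fin m → (Fin (suc m) → Fin (suc m)) → (Fin (suc m) → Fin (suc m))
swapAt k σ a with a ≟ inject₁ k | a ≟ suc k
... | yes _ | _     = σ (suc k)
... | no _  | yes _ = σ (inject₁ k)
... | no _  | no _  = σ a

AllowedSwap : ∀ {m} → Profile m → Assignment m → Assignment m → Set
AllowedSwap {m} P σ τ =
  Σ (Fin m) λ k →
    (_≻[_]_ P (obj σ (suc k)) (inject₁ k) (obj σ (inject₁ k))
     × _≻[_]_ P (obj σ (inject₁ k)) (suc k) (obj σ (suc k)))
    × (∀ a → obj τ a ≡ swapAt k (obj σ) a)

record SwapSequence {m : ℕ} (P : Profile m) (t : ℕ) : Set where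
  field
    σ     : Fin (suc t) → Assignment m
    init  : ∀ a → obj (σ Data.Fin.zero) a ≡ a
    steps : (r : Fin t) → AllowedSwap P (σ (inject₁ r)) (σ (suc r))
open SwapSequence public

module Submission where

-- Every allowed swap strictly improves the objects of both agents involved and leaves the
-- others untouched, so along a swap sequence each agent's object only ever gets weakly
-- better. An object an agent holds at two times is therefore also held at every time in
-- between, by antisymmetry of its weak preference.

open import Defs
open import Level using (Level)
open import Data.Nat using (ℕ; suc)
open import Data.Fin using (Fin; _<_; _≤_; inject₁; suc; _≟_)
open import Data.Fin.Induction using (<-weakInduction-startingFrom)
open import Data.Product using (_,_)
open import Data.Sum using (inj₁; inj₂)
open import Function using (flip)
open import Relation.Nullary using (yes; no)
open import Relation.Binary using (Rel; Reflexive; Transitive; IsPartialOrder; IsStrictTotalOrder)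
import Relation.Binary.Construct.StrictToNonStrict as StrictToNonStrict
open import Relation.Binary.PropositionalEquality using (_≡_; refl; sym; subst)

stepwise-mono : ∀ {a ℓ : Level} {A : Set a} {R : Rel A ℓ} {t : ℕ} →
                Reflexive R → Transitive R →
                (f : Fin (suc t) → A) → (∀ r → R (f (inject₁ r)) (f (suc r))) →
                ∀ {i j} → i ≤ j → R (f i) (f j)
stepwise-mono {R = R} R-refl R-trans f step {i} =
  <-weakInduction-startingFrom (λ j → R (f i) (f j)) R-refl (λ j fi≤fj → R-trans fi≤fj (step j))

module _ {m : ℕ} (P : Profile m) where

  _⪰[_]_ : Fin (suc m) → Fin (suc m) → Fin (suc m) → Set
  x ⪰[ a ] y = StrictToNonStrict._≤_ _≡_ (λ u v → _≻[_]_ P u a v) x y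

  ⪰-isPartialOrder : ∀ a → IsPartialOrder _≡_ (λ x y → x ⪰[ a ] y)
  ⪰-isPartialOrder a = StrictToNonStrict.isPartialOrder _≡_ _
    (IsStrictTotalOrder.isStrictPartialOrder (isSTO P a))

  allowedSwap-improves : ∀ {σ τ} → AllowedSwap P σ τ → ∀ a → obj τ a ⪰[ a ] obj σ a
  allowedSwap-improves {σ} (k , (left , right) , τ≡swap) a
    with a ≟ inject₁ k | a ≟ suc k | τ≡swap a
  ... | yes refl | _        | τa≡ = subst (λ x → x ⪰[ a ] obj σ a) (sym τa≡) (inj₁ left)
  ... | no _     | yes refl | τa≡ = subst (λ x → x ⪰[ a ] obj σ a) (sym τa≡) (inj₁ right)
  ... | no _     | no _     | τa≡ = inj₂ τa≡

  swapSequence-improves : ∀ {t} (S : SwapSequence P t) a {i j : Fin (suc t)} →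
                          i ≤ j → obj (σ S j) a ⪰[ a ] obj (σ S i) a
  swapSequence-improves S a =
    stepwise-mono {R = λ x y → y ⪰[ a ] x} ⪰-refl (flip ⪰-trans) (λ r → obj (σ S r) a)
      (λ r → allowedSwap-improves {σ S (inject₁ r)} {σ S (suc r)} (steps S r) a)
    where
    open IsPartialOrder (⪰-isPartialOrder a) renaming (refl to ⪰-refl; trans to ⪰-trans)

lemma1 : ∀ {m t : ℕ} (P : Profile m) (S : SwapSequence P t)
           (i j : Fin (suc t)) (q : Fin (suc m)) →
           i < j →
           obj (σ S i) q ≡ obj (σ S j) q →
           ∀ (d : Fin (suc t)) → i ≤ d → d ≤ j →
           obj (σ S d) q ≡ obj (σ S i) q
lemma1 P S i j q _ σi≡σj d i≤d d≤j =
  antisym (swapSequence-improves P S q i≤d)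
          (≤-respˡ-≈ (sym σi≡σj) (swapSequence-improves P S q d≤j))
  where open IsPartialOrder (⪰-isPartialOrder P q)
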